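{- Let $m\ge 1$ and let $B_{2m}$ be the $2m\times 2m$ $(0,1)$-matrix whose cell $(i,j)$ contains $1$ if $\lfloor (i-1)/m\rfloor=\lfloor (j-1)/m\rfloor$ and $0$ otherwise. Then $B_{2m}$ has a critical set of size $2m^2-m$.
   Context: $\Lambda_{n}^{x}$ is the set of $n\times n$ $(0,1)$-matrices with every row sum and every column sum equal to $x$; $B_{2m}\in\Lambda_{2m}^m$. A matrix $M$ is identified with the set of triples $\{(i,j,M_{ij})\}$. A subset $D\subseteq M$ is a defining set for $M$ if $M$ is the unique element of $\Lambda_{2m}^m$ containing $D$; a critical set is a defining set none of whose proper subsets is a defining set; its size is its number of triples. -}

module Defs where

open import Data.Nat using (ℕ; _*_; NonZero; _≡ᵇ_)
open import Data.Bool using (Bool; true; false; T; _∧_)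
open import Data.Fin using (Fin; toℕ)
open import Data.Nat.DivMod using (_/_)
open import Data.List using (length; filter; allFin; map)
open import Data.Nat.ListAction using (sum)
open import Data.Product using (_×_; Σ)
open import Relation.Binary.PropositionalEquality using (_≡_)
open import Relation.Nullary using (¬_)
open import Data.Bool.Properties using (T?)

-- An n×n (0,1)-matrix: entry true = 1, false = 0. Indices are 0-based Fin n.
Matrix : ℕ → Set
Matrix n = Fin n → Fin n → Bool

count : ∀ {n} → (Fin n → Bool) → ℕ
count {n} f = length (filter (λ i → T? (f i)) (allFin n))

rowSum : ∀ {n} → Matrix n → Fin n → ℕ
rowSum M i = count (λ j → M i j)

colSum : ∀ {n} → Matrix n → Fin n → ℕ
colSum M j = count (λ i → M i j)

InΛ : (n x : ℕ) → Matrix n → Set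
InΛ n x M = (∀ i → rowSum M i ≡ x) × (∀ j → colSum M j ≡ x)

-- B_{2m}: cell (i,j) (1-based) contains 1 iff ⌊(i-1)/m⌋ = ⌊(j-1)/m⌋.
-- With 0-based indices i' = i-1, j' = j-1 this is ⌊i'/m⌋ = ⌊j'/m⌋.
Bmat : (m : ℕ) → .{{_ : NonZero m}} → Matrix (2 * m)
Bmat m i j = (toℕ i / m) ≡ᵇ (toℕ j / m)

-- A subset D ⊆ M of the triples {(i,j,M i j)} of M is determined by the set
-- of cells it uses; we represent it by its cell-indicator S : Fin n → Fin n → Bool.
CellSet : ℕ → Set
CellSet n = Fin n → Fin n → Bool

size : ∀ {n} → CellSet n → ℕ
size {n} S = sum (map (λ i → count (λ j → S i j)) (allFin n))

Contains : ∀ {n} → Matrix n → Matrix n → CellSet n → Set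
Contains N M S = ∀ i j → T (S i j) → N i j ≡ M i j

IsDefiningSet : (n x : ℕ) → Matrix n → CellSet n → Set
IsDefiningSet n x M S =
  ∀ (N : Matrix n) → InΛ n x N → Contains N M S → ∀ i j → N i j ≡ M i j

_⊆c_ : ∀ {n} → CellSet n → CellSet n → Set
S' ⊆c S = ∀ i j → T (S' i j) → T (S i j)

_⊂c_ : ∀ {n} → CellSet n → CellSet n → Set
S' ⊂c S = S' ⊆c S × Σ _ λ i → Σ _ λ j → T (S i j) × ¬ T (S' i j)

IsCriticalSet : (n x : ℕ) → Matrix n → CellSet n → Set
IsCriticalSet n x M S =
  IsDefiningSet n x M S × (∀ S' → S' ⊂c S → ¬ IsDefiningSet n x M S')

module Submission where

-- B_{2m} = Bmat m consists of two m×m diagonal blocks of ones.  Writing the index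
-- ⟨ s , i ⟩ = combine s i for offset i < m in block s ∈ {0,1}, B ⟨s,i⟩ ⟨t,j⟩ = 1 iff s = t,
-- and the critical set is
--   S = {⟨0,i⟩⟨0,j⟩ : j < i} ∪ {⟨0,i⟩⟨1,l⟩ : i ≤ l} ∪ {⟨1,k⟩⟨0,j⟩ : k < j} ∪ {⟨1,k⟩⟨1,l⟩ : l < k}.
-- Every upper row meets S in m cells and every lower row in m - 1, so |S| = 2m² - m.
-- S is defining: a line of a matrix in Λ is forced once it is known at all zeros (or all
-- ones) of that line of B, since line sums agree.  By strong induction on t this forces, in
-- order, upper row t, upper column t, lower row t and lower column t.
-- S is critical: every cell of S is the only cell of S among the four corners of some
-- interchange of B (a 2×2 submatrix [[1,0],[0,1]]); switching that interchange stays in Λ and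
-- changes B only at the corners, so a subset of S lacking that cell is not defining.

open import Defs
open import Data.Bool using (Bool; true; false; T; not; _∧_; _∨_; if_then_else_)
open import Data.Bool.Properties using (T?; ∨-comm; ∨-zeroʳ; ∧-comm)
open import Data.Empty using (⊥; ⊥-elim)
open import Data.Fin using (Fin; _<_; zero; suc; toℕ; combine; remQuot; quotient; remainder; _↑ˡ_; _↑ʳ_)
open import Data.Fin.Induction using (<-wellFounded; Acc; acc)
open import Data.Fin.Patterns using (0F; 1F)
open import Data.Fin.Properties using (_≟_; <-cmp; combine-remQuot; remQuot-combine; toℕ-combine; toℕ<n; combine-injectiveˡ)
open import Data.List using (length; filter; map; tabulate)
open import Data.List.Properties using (map-tabulate)
import Data.Nat as ℕ
open import Data.Nat using (ℕ; zero; suc; pred; _+_; _*_; _∸_; _≤_; _<ᵇ_; _≤ᵇ_; _≡ᵇ_; z≤n; s≤s; NonZero)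
open import Data.Nat.DivMod using (_/_; /-congˡ; +-distrib-/-∣ˡ; m*n/n≡m; m<n⇒m/n≡0)
open import Data.Nat.Divisibility using (m∣m*n)
import Data.Nat.ListAction as List
open import Data.Nat.Properties
  using ( +-0-commutativeMonoid; +-assoc; +-identityʳ; +-suc; +-cancelʳ-≡; *-comm; *-zeroʳ
        ; *-identityʳ; *-distribˡ-∸; +-∸-assoc; m∸n+n≡m; m+n∸m≡n; m≤m*n; suc-injective
        ; ≤-refl; <-irrefl; <⇒≤; <⇒≱; m≤n⇒m≤1+n; <ᵇ⇒<; <⇒<ᵇ; ≤ᵇ⇒≤; ≤⇒≤ᵇ )
open import Algebra.Properties.CommutativeMonoid.Sum +-0-commutativeMonoid
  using (sum-cong-≗; ∑-distrib-+) renaming (sum to ∑)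
open import Data.Product using (_×_; _,_; Σ)
open import Data.Sum using (_⊎_; inj₁; inj₂)
open import Function using (_∘_)
open import Relation.Binary.Definitions using (tri<; tri≈; tri>)
open import Relation.Binary.PropositionalEquality
open import Relation.Nullary using (¬_; Dec; does; yes; no)
open import Relation.Nullary.Decidable using (dec-true; dec-false)

true-and-false : ∀ {b} → b ≡ true → b ≡ false → ⊥
true-and-false refl ()

bit : Bool → ℕ
bit true  = 1
bit false = 0

tally : ∀ {n} → (Fin n → Bool) → ℕ
tally f = ∑ (bit ∘ f)

count-tabulate : ∀ {n k} (f : Fin k → Bool) (h : Fin n → Fin k) →
  length (filter (λ i → T? (f i)) (tabulate h)) ≡ tally (f ∘ h)
count-tabulate {zero}  f h = refl
count-tabulate {suc n} f h with f (h zero)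
... | true  = cong suc (count-tabulate f (h ∘ suc))
... | false = count-tabulate f (h ∘ suc)

count≡tally : ∀ {n} (f : Fin n → Bool) → count f ≡ tally f
count≡tally f = count-tabulate f (λ i → i)

sum-tabulate : ∀ {n} (g : Fin n → ℕ) → List.sum (tabulate g) ≡ ∑ g
sum-tabulate {zero}  g = refl
sum-tabulate {suc n} g = cong (g zero +_) (sum-tabulate (g ∘ suc))

size≡∑tally : ∀ {n} (S : CellSet n) → size S ≡ ∑ (λ a → tally (S a))
size≡∑tally {n} S = begin
  List.sum (map (λ a → count (S a)) (tabulate (λ a → a)))
    ≡⟨ cong List.sum (map-tabulate {n = n} (λ a → a) (λ a → count (S a))) ⟩
  List.sum (tabulate (λ a → count (S a)))     ≡⟨ sum-tabulate {n} (λ a → count (S a)) ⟩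
  ∑ (λ a → count (S a))                       ≡⟨ sum-cong-≗ (λ a → count≡tally (S a)) ⟩
  ∑ (λ a → tally (S a))                       ∎
  where open ≡-Reasoning

tally-cong : ∀ {n} {f g : Fin n → Bool} → (∀ i → f i ≡ g i) → tally f ≡ tally g
tally-cong f≗g = sum-cong-≗ (cong bit ∘ f≗g)

∑-const : ∀ n c → ∑ {n} (λ _ → c) ≡ n * c
∑-const zero    c = refl
∑-const (suc n) c = cong (c +_) (∑-const n c)

∑-↑ : ∀ n {p} (f : Fin (n + p) → ℕ) → ∑ f ≡ ∑ (λ i → f (i ↑ˡ p)) + ∑ (λ j → f (n ↑ʳ j))
∑-↑ zero    f = refl
∑-↑ (suc n) f = trans (cong (f zero +_) (∑-↑ n (f ∘ suc))) (sym (+-assoc (f zero) _ _))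

∑-combine : ∀ k {n} (f : Fin (k * n) → ℕ) →
  ∑ f ≡ ∑ {k} (λ s → ∑ {n} (λ i → f (combine s i)))
∑-combine zero    f = refl
∑-combine (suc k) {n} f =
  trans (∑-↑ n f) (cong (∑ {n} (λ i → f (combine {suc k} zero i)) +_) (∑-combine k (λ a → f (n ↑ʳ a))))

tally-false : ∀ {n} → tally {n} (λ _ → false) ≡ 0
tally-false {n} = trans (∑-const n 0) (*-zeroʳ n)

tally-true : ∀ {n} → tally {n} (λ _ → true) ≡ n
tally-true {n} = trans (∑-const n 1) (*-identityʳ n)

tally-complement : ∀ {n} (f : Fin n → Bool) → tally f + tally (not ∘ f) ≡ n
tally-complement {n} f = begin
  tally f + tally (not ∘ f)                  ≡⟨ ∑-distrib-+ (bit ∘ f) (bit ∘ not ∘ f) ⟨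
  ∑ (λ i → bit (f i) + bit (not (f i)))      ≡⟨ sum-cong-≗ (λ i → bit+bit-not (f i)) ⟩
  tally {n} (λ _ → true)                     ≡⟨ tally-true ⟩
  n                                          ∎
  where
  open ≡-Reasoning
  bit+bit-not : ∀ b → bit b + bit (not b) ≡ 1
  bit+bit-not true  = refl
  bit+bit-not false = refl

tally-below : ∀ {n} c → c ≤ n → tally {n} (λ y → toℕ y <ᵇ c) ≡ c
tally-below {n} zero _        = tally-false {n}
tally-below (suc c) (s≤s c≤n) = cong suc (tally-below c c≤n)

≤ᵇ-complement : ∀ x y → (x ≤ᵇ y) ≡ not (y <ᵇ x)
≤ᵇ-complement zero          y       = refl
≤ᵇ-complement (suc x)       zero    = refl
≤ᵇ-complement (suc zero)    (suc y) = refl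
≤ᵇ-complement (suc (suc x)) (suc y) = ≤ᵇ-complement (suc x) y

tally-at-least : ∀ {n} c → c ≤ n → tally {n} (λ y → c ≤ᵇ toℕ y) ≡ n ∸ c
tally-at-least {n} c c≤n = begin
  tally at-least                                 ≡⟨ m+n∸m≡n c (tally at-least) ⟨
  (c + tally at-least) ∸ c                       ≡⟨ cong (λ x → (x + tally at-least) ∸ c) (tally-below c c≤n) ⟨
  (tally below + tally at-least) ∸ c             ≡⟨ cong (λ x → (tally below + x) ∸ c) (tally-cong {n} (λ y → ≤ᵇ-complement c (toℕ y))) ⟩
  (tally below + tally (not ∘ below)) ∸ c        ≡⟨ cong (_∸ c) (tally-complement below) ⟩
  n ∸ c                                          ∎
  where
  open ≡-Reasoning
  below at-least : Fin n → Bool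
  below y = toℕ y <ᵇ c
  at-least y = c ≤ᵇ toℕ y

<ᵇ-irrefl : ∀ x → ¬ T (x <ᵇ x)
<ᵇ-irrefl x x<x = <-irrefl refl (<ᵇ⇒< x x x<x)

<ᵇ-not-≥ᵇ : ∀ x y → T (x <ᵇ y) → ¬ T (y ≤ᵇ x)
<ᵇ-not-≥ᵇ x y x<y y≤x = <⇒≱ (<ᵇ⇒< x y x<y) (≤ᵇ⇒≤ y x y≤x)

tally-mono : ∀ {n} {f g : Fin n → Bool} → (∀ i → T (f i) → T (g i)) → tally f ≤ tally g
tally-mono {zero}          _   = z≤n
tally-mono {suc n} {f} {g} f⇒g with f zero | g zero | f⇒g zero
... | true  | true  | _ = s≤s (tally-mono (f⇒g ∘ suc))
... | false | true  | _ = m≤n⇒m≤1+n (tally-mono (f⇒g ∘ suc))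
... | false | false | _ = tally-mono (f⇒g ∘ suc)
... | true  | false | h = ⊥-elim (h _)

-- If f implies g pointwise and both have the same tally, then f = g: a true entry of g
-- missing from f would make the tally of f strictly smaller.
tally-forces : ∀ {n} {f g : Fin n → Bool} → (∀ i → T (f i) → T (g i)) →
  tally f ≡ tally g → ∀ i → f i ≡ g i
tally-forces {suc n} {f} {g} f⇒g same i with f zero in f₀ | g zero in g₀ | f⇒g zero
tally-forces f⇒g same zero    | true  | true  | _ = trans f₀ (sym g₀)
tally-forces f⇒g same (suc i) | true  | true  | _ = tally-forces (f⇒g ∘ suc) (suc-injective same) i
tally-forces f⇒g same zero    | false | false | _ = trans f₀ (sym g₀)
tally-forces f⇒g same (suc i) | false | false | _ = tally-forces (f⇒g ∘ suc) same i
tally-forces f⇒g same i       | false | true  | _ =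
  ⊥-elim (<-irrefl same (s≤s (tally-mono (f⇒g ∘ suc))))
tally-forces f⇒g same i       | true  | false | h = ⊥-elim (h _)

tally-indicator : ∀ {n} (u : Fin n) → tally (λ i → does (i ≟ u)) ≡ 1
tally-indicator {suc n} zero    = cong suc (tally-false {n})
tally-indicator {suc n} (suc u) = tally-indicator u

inPair : ∀ {n} → Fin n → Fin n → Fin n → Bool
inPair u v i = does (i ≟ u) ∨ does (i ≟ v)

inPair-fst : ∀ {n} (u v : Fin n) → inPair u v u ≡ true
inPair-fst u v rewrite dec-true (u ≟ u) refl = refl

inPair-snd : ∀ {n} (u v : Fin n) → inPair u v v ≡ true
inPair-snd u v rewrite dec-true (v ≟ v) refl = ∨-zeroʳ _

inPair-neither : ∀ {n} {u v i : Fin n} → i ≢ u → i ≢ v → inPair u v i ≡ false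
inPair-neither {u = u} {v} {i} i≢u i≢v rewrite dec-false (i ≟ u) i≢u | dec-false (i ≟ v) i≢v = refl

inPair-true : ∀ {n} {u v i : Fin n} → inPair u v i ≡ true → i ≡ u ⊎ i ≡ v
inPair-true {u = u} {v} {i} e with i ≟ u | i ≟ v
... | yes i≡u | _       = inj₁ i≡u
... | no  _   | yes i≡v = inj₂ i≡v

toggle : ∀ {n} → Fin n → Fin n → (Fin n → Bool) → Fin n → Bool
toggle u v f i = if inPair u v i then not (f i) else f i

toggle-comm : ∀ {n} (u v : Fin n) f i → toggle u v f i ≡ toggle v u f i
toggle-comm u v f i =
  cong (λ b → if b then not (f i) else f i) (∨-comm (does (i ≟ u)) (does (i ≟ v)))

-- Toggling a true entry at u and a false entry at v keeps the tally: adding the indicator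
-- of u to the toggled vector gives, pointwise, f plus the indicator of v.
tally-toggle-true-false : ∀ {n} {u v : Fin n} {f} → u ≢ v → f u ≡ true → f v ≡ false →
  tally (toggle u v f) ≡ tally f
tally-toggle-true-false {n} {u} {v} {f} u≢v fu fv = +-cancelʳ-≡ _ _ _ (begin
  tally (toggle u v f) + 1                               ≡⟨ cong (tally (toggle u v f) +_) (tally-indicator u) ⟨
  tally (toggle u v f) + tally (λ i → does (i ≟ u))      ≡⟨ ∑-distrib-+ (bit ∘ toggle u v f) _ ⟨
  ∑ (λ i → bit (toggle u v f i) + bit (does (i ≟ u)))    ≡⟨ sum-cong-≗ balance ⟩
  ∑ (λ i → bit (f i) + bit (does (i ≟ v)))               ≡⟨ ∑-distrib-+ (bit ∘ f) _ ⟩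
  tally f + tally (λ i → does (i ≟ v))                   ≡⟨ cong (tally f +_) (tally-indicator v) ⟩
  tally f + 1                                            ∎)
  where
  open ≡-Reasoning
  balance : ∀ i → bit (toggle u v f i) + bit (does (i ≟ u)) ≡ bit (f i) + bit (does (i ≟ v))
  balance i with i ≟ u | i ≟ v
  ... | yes refl | yes refl = ⊥-elim (u≢v refl)
  ... | yes refl | no  _    rewrite fu = refl
  ... | no  _    | yes refl rewrite fv = refl
  ... | no  _    | no  _    = refl

tally-toggle : ∀ {n} {u v : Fin n} {f} → u ≢ v → f u ≡ not (f v) →
  tally (toggle u v f) ≡ tally f
tally-toggle {v = v} {f} u≢v fu with f v in fv
... | false = tally-toggle-true-false u≢v fu fv
... | true  = trans (tally-cong (toggle-comm _ _ f)) (tally-toggle-true-false (u≢v ∘ sym) fv fu)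

row-tally : ∀ {n x M} → InΛ n x M → ∀ a → tally (M a) ≡ x
row-tally {M = M} (rows , _) a = trans (sym (count≡tally (M a))) (rows a)

col-tally : ∀ {n x M} → InΛ n x M → ∀ b → tally (λ a → M a b) ≡ x
col-tally {M = M} (_ , cols) b = trans (sym (count≡tally (λ a → M a b))) (cols b)

-- Two matrices of Λ that agree at every zero of row a of M agree on the whole row:
-- the ones of N's row then lie among those of M's row, and the row sums are equal.
row-forced-by-zeros : ∀ {n x} {M N : Matrix n} → InΛ n x M → InΛ n x N → ∀ a →
  (∀ b → M a b ≡ false → N a b ≡ M a b) → ∀ b → N a b ≡ M a b
row-forced-by-zeros {M = M} {N} M∈Λ N∈Λ a agree =
  tally-forces N⇒M (trans (row-tally N∈Λ a) (sym (row-tally M∈Λ a)))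
  where
  N⇒M : ∀ b → T (N a b) → T (M a b)
  N⇒M b Nab with M a b in Mab
  ... | true  = _
  ... | false = subst T (trans (agree b Mab) Mab) Nab

col-forced-by-ones : ∀ {n x} {M N : Matrix n} → InΛ n x M → InΛ n x N → ∀ b →
  (∀ a → M a b ≡ true → N a b ≡ M a b) → ∀ a → N a b ≡ M a b
col-forced-by-ones {M = M} {N} M∈Λ N∈Λ b agree a =
  sym (tally-forces M⇒N (trans (col-tally M∈Λ b) (sym (col-tally N∈Λ b))) a)
  where
  M⇒N : ∀ a → T (M a b) → T (N a b)
  M⇒N a Mab with M a b in eq
  ... | true = subst T (sym (trans (agree a eq) eq)) Mab

transpose : ∀ {n} → Matrix n → Matrix n
transpose M a b = M b a

record Interchange {n} (M : Matrix n) : Set where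
  field
    r₁ r₂ c₁ c₂ : Fin n
    r₁≢r₂ : r₁ ≢ r₂
    c₁≢c₂ : c₁ ≢ c₂
    M₁₁ : M r₁ c₁ ≡ true
    M₂₂ : M r₂ c₂ ≡ true
    M₁₂ : M r₁ c₂ ≡ false
    M₂₁ : M r₂ c₁ ≡ false

module _ {n} {M : Matrix n} (I : Interchange M) where
  open Interchange I

  switch : Matrix n
  switch a b = if inPair r₁ r₂ a ∧ inPair c₁ c₂ b then not (M a b) else M a b

  Corner : Fin n → Fin n → Set
  Corner a b = (a ≡ r₁ ⊎ a ≡ r₂) × (b ≡ c₁ ⊎ b ≡ c₂)

  switch-on-row : ∀ {a} → inPair r₁ r₂ a ≡ true → ∀ b → switch a b ≡ toggle c₁ c₂ (M a) b
  switch-on-row e b rewrite e = refl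

  switch-off-row : ∀ {a} → inPair r₁ r₂ a ≡ false → ∀ b → switch a b ≡ M a b
  switch-off-row e b rewrite e = refl

  switch-row-toggled : ∀ {a x} → inPair r₁ r₂ a ≡ true → M a c₁ ≡ not (M a c₂) →
    tally (M a) ≡ x → tally (switch a) ≡ x
  switch-row-toggled on opposite sum-a =
    trans (tally-cong (switch-on-row on)) (trans (tally-toggle c₁≢c₂ opposite) sum-a)

  switch-row : ∀ {x} a → tally (M a) ≡ x → Dec (a ≡ r₁) → Dec (a ≡ r₂) → tally (switch a) ≡ x
  switch-row a sum-a (yes refl) _          =
    switch-row-toggled (inPair-fst r₁ r₂) (trans M₁₁ (cong not (sym M₁₂))) sum-a
  switch-row a sum-a (no _)     (yes refl) =
    switch-row-toggled (inPair-snd r₁ r₂) (trans M₂₁ (cong not (sym M₂₂))) sum-a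
  switch-row a sum-a (no a≢r₁)  (no a≢r₂)  =
    trans (tally-cong (switch-off-row (inPair-neither a≢r₁ a≢r₂))) sum-a

  switch-rows : ∀ {x} → (∀ a → tally (M a) ≡ x) → ∀ a → tally (switch a) ≡ x
  switch-rows rows a = switch-row a (rows a) (a ≟ r₁) (a ≟ r₂)

-- Columns are handled as rows of the transpose.
transpose-interchange : ∀ {n} {M : Matrix n} → Interchange M → Interchange (transpose M)
transpose-interchange I = record
  { r₁ = c₁ ; r₂ = c₂ ; c₁ = r₁ ; c₂ = r₂ ; r₁≢r₂ = c₁≢c₂ ; c₁≢c₂ = r₁≢r₂
  ; M₁₁ = M₁₁ ; M₂₂ = M₂₂ ; M₁₂ = M₂₁ ; M₂₁ = M₁₂ }
  where open Interchange I

switch-transpose : ∀ {n} {M : Matrix n} (I : Interchange M) a b →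
  switch (transpose-interchange I) b a ≡ switch I a b
switch-transpose {M = M} I a b =
  cong (λ t → if t then not (M a b) else M a b) (∧-comm (inPair c₁ c₂ b) (inPair r₁ r₂ a))
  where open Interchange I

switch-InΛ : ∀ {n x} {M : Matrix n} → InΛ n x M → (I : Interchange M) → InΛ n x (switch I)
switch-InΛ {M = M} M∈Λ I = rows , cols
  where
  rows : ∀ a → rowSum (switch I) a ≡ _
  rows a = trans (count≡tally (switch I a)) (switch-rows I (row-tally M∈Λ) a)
  cols : ∀ b → colSum (switch I) b ≡ _
  cols b = begin
    colSum (switch I) b                          ≡⟨ count≡tally (λ a → switch I a b) ⟩
    tally (λ a → switch I a b)                   ≡⟨ tally-cong (λ a → switch-transpose I a b) ⟨
    tally (switch (transpose-interchange I) b)   ≡⟨ switch-rows (transpose-interchange I) (col-tally M∈Λ) b ⟩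
    _                                            ∎
    where open ≡-Reasoning

-- A cell set avoiding all four corners of an interchange of M is not defining: the switched
-- matrix lies in Λ, contains it, and differs from M at corner (r₁, c₁).
avoiding-corners-not-defining : ∀ {n x} {M : Matrix n} {S : CellSet n} → InΛ n x M →
  (I : Interchange M) → (∀ a b → Corner I a b → ¬ T (S a b)) → ¬ IsDefiningSet n x M S
avoiding-corners-not-defining {M = M} {S} M∈Λ I avoid defines =
  flipped (defines (switch I) (switch-InΛ M∈Λ I) agrees r₁ c₁)
  where
  open Interchange I
  agrees : Contains (switch I) M S
  agrees a b Sab with inPair r₁ r₂ a in ea | inPair c₁ c₂ b in eb
  ... | false | _     = refl
  ... | true  | false = refl
  ... | true  | true  = ⊥-elim (avoid a b (inPair-true ea , inPair-true eb) Sab)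
  flipped : switch I r₁ c₁ ≢ M r₁ c₁
  flipped rewrite inPair-fst r₁ r₂ | inPair-fst c₁ c₂ | M₁₁ = λ ()

Isolates : ∀ {n} {M : Matrix n} → Interchange M → CellSet n → Fin n → Fin n → Set
Isolates I S a b = ∀ p q → Corner I p q → T (S p q) → p ≡ a × q ≡ b

-- If every cell of S is isolated by some interchange, no proper subset of S is defining:
-- a proper subset misses some cell, hence avoids all corners of its isolating interchange.
minimal-if-isolated : ∀ {n x} {M : Matrix n} {S : CellSet n} → InΛ n x M →
  (∀ a b → T (S a b) → Σ (Interchange M) λ I → Isolates I S a b) →
  ∀ S' → S' ⊂c S → ¬ IsDefiningSet n x M S'
minimal-if-isolated M∈Λ isolate S' (S'⊆S , a , b , Sab , ¬S'ab) with isolate a b Sab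
... | I , only = avoiding-corners-not-defining M∈Λ I avoid
  where
  avoid : ∀ p q → Corner I p q → ¬ T (S' p q)
  avoid p q corner S'pq with only p q corner (S'⊆S p q S'pq)
  ... | refl , refl = ¬S'ab S'pq

which-of-two : ∀ {A : Set} (f : Fin 2 → A) {p} → p ≡ f 0F ⊎ p ≡ f 1F → Σ (Fin 2) λ s → p ≡ f s
which-of-two f (inj₁ e) = 0F , e
which-of-two f (inj₂ e) = 1F , e

module Block (m : ℕ) .{{_ : NonZero m}} where

  B : Matrix (2 * m)
  B = Bmat m

  ⟨_,_⟩ : Fin 2 → Fin m → Fin (2 * m)
  ⟨ s , i ⟩ = combine s i

  cell-cases : (P : Fin (2 * m) → Set) → (∀ s i → P ⟨ s , i ⟩) → ∀ a → P a
  cell-cases P h a = subst P (combine-remQuot {2} m a) (h (quotient m a) (remainder {2} m a))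

  ∑-blocks : (f : Fin (2 * m) → ℕ) → ∑ f ≡ ∑ {m} (λ i → f ⟨ 0F , i ⟩) + ∑ {m} (λ i → f ⟨ 1F , i ⟩)
  ∑-blocks f = trans (∑-combine 2 {m} f) (cong (∑ {m} (λ i → f ⟨ 0F , i ⟩) +_) (+-identityʳ _))

  tally-blocks : (g : Fin (2 * m) → Bool) →
    tally g ≡ tally {m} (λ j → g ⟨ 0F , j ⟩) + tally {m} (λ j → g ⟨ 1F , j ⟩)
  tally-blocks g = ∑-blocks (bit ∘ g)

  block-of : ∀ s i → toℕ ⟨ s , i ⟩ / m ≡ toℕ s
  block-of s i = begin
    toℕ (combine s i) / m         ≡⟨ /-congˡ (toℕ-combine s i) ⟩
    (m * toℕ s + toℕ i) / m       ≡⟨ +-distrib-/-∣ˡ (toℕ i) (m∣m*n (toℕ s)) ⟩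
    m * toℕ s / m + toℕ i / m     ≡⟨ cong₂ _+_ (trans (/-congˡ (*-comm m (toℕ s))) (m*n/n≡m (toℕ s) m))
                                               (m<n⇒m/n≡0 (toℕ<n i)) ⟩
    toℕ s + 0                     ≡⟨ +-identityʳ (toℕ s) ⟩
    toℕ s                         ∎
    where open ≡-Reasoning

  B-cells : ∀ s i t j → B ⟨ s , i ⟩ ⟨ t , j ⟩ ≡ (toℕ s ≡ᵇ toℕ t)
  B-cells s i t j = cong₂ _≡ᵇ_ (block-of s i) (block-of t j)

  B-rows : ∀ a → tally (B a) ≡ m
  B-rows = cell-cases (λ a → tally (B a) ≡ m) row
    where
    one-block : ∀ s → tally {m} (λ _ → toℕ s ≡ᵇ 0) + tally {m} (λ _ → toℕ s ≡ᵇ 1) ≡ m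
    one-block 0F = trans (cong₂ _+_ (tally-true {m}) (tally-false {m})) (+-identityʳ m)
    one-block 1F = cong₂ _+_ (tally-false {m}) (tally-true {m})
    row : ∀ s i → tally (B ⟨ s , i ⟩) ≡ m
    row s i = trans (tally-blocks (B ⟨ s , i ⟩))
      (trans (cong₂ _+_ (tally-cong (B-cells s i 0F)) (tally-cong (B-cells s i 1F))) (one-block s))

  B-symmetric : ∀ a b → B a b ≡ B b a
  B-symmetric a b = ≡ᵇ-sym (toℕ a / m) (toℕ b / m)
    where
    ≡ᵇ-sym : ∀ x y → (x ≡ᵇ y) ≡ (y ≡ᵇ x)
    ≡ᵇ-sym zero    zero    = refl
    ≡ᵇ-sym zero    (suc y) = refl
    ≡ᵇ-sym (suc x) zero    = refl
    ≡ᵇ-sym (suc x) (suc y) = ≡ᵇ-sym x y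

  B-InΛ : InΛ (2 * m) m B
  B-InΛ = (λ a → trans (count≡tally (B a)) (B-rows a))
        , (λ b → trans (count≡tally (λ a → B a b)) (trans (tally-cong (λ a → B-symmetric a b)) (B-rows b)))

  selected : Fin 2 → Fin m → Fin 2 → Fin m → Bool
  selected 0F i 0F j = toℕ j <ᵇ toℕ i
  selected 0F i 1F l = toℕ i ≤ᵇ toℕ l
  selected 1F k 0F j = toℕ k <ᵇ toℕ j
  selected 1F k 1F l = toℕ l <ᵇ toℕ k

  selected′ : Fin 2 × Fin m → Fin 2 × Fin m → Bool
  selected′ (s , i) (t , j) = selected s i t j

  S : CellSet (2 * m)
  S a b = selected′ (remQuot {2} m a) (remQuot {2} m b)

  S-cells : ∀ s i t j → S ⟨ s , i ⟩ ⟨ t , j ⟩ ≡ selected s i t j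
  S-cells s i t j = cong₂ selected′ (remQuot-combine s i) (remQuot-combine t j)

  -- Upper row i: the j < i of the first block and the l ≥ i of the second are complementary.
  S-row-upper : ∀ i → tally (S ⟨ 0F , i ⟩) ≡ m
  S-row-upper i = begin
    tally (S ⟨ 0F , i ⟩)                                        ≡⟨ tally-blocks (S ⟨ 0F , i ⟩) ⟩
    tally (λ j → S ⟨ 0F , i ⟩ ⟨ 0F , j ⟩) + tally (λ l → S ⟨ 0F , i ⟩ ⟨ 1F , l ⟩)
      ≡⟨ cong₂ _+_ (tally-cong (S-cells 0F i 0F))
                   (tally-cong (λ l → trans (S-cells 0F i 1F l) (≤ᵇ-complement (toℕ i) (toℕ l)))) ⟩
    tally below-i + tally (not ∘ below-i)                       ≡⟨ tally-complement below-i ⟩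
    m                                                           ∎
    where
    open ≡-Reasoning
    below-i : Fin m → Bool
    below-i j = toℕ j <ᵇ toℕ i

  -- Lower row k: the j > k of the first block and the l < k of the second, m - 1 in all.
  S-row-lower : ∀ k → tally (S ⟨ 1F , k ⟩) ≡ m ∸ 1
  S-row-lower k = begin
    tally (S ⟨ 1F , k ⟩)                                        ≡⟨ tally-blocks (S ⟨ 1F , k ⟩) ⟩
    tally (λ j → S ⟨ 1F , k ⟩ ⟨ 0F , j ⟩) + tally (λ l → S ⟨ 1F , k ⟩ ⟨ 1F , l ⟩)
      ≡⟨ cong₂ _+_ (tally-cong (S-cells 1F k 0F)) (tally-cong (S-cells 1F k 1F)) ⟩
    tally {m} (λ j → suc (toℕ k) ≤ᵇ toℕ j) + tally {m} (λ l → toℕ l <ᵇ toℕ k)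
      ≡⟨ cong₂ _+_ (tally-at-least (suc (toℕ k)) k<m) (tally-below (toℕ k) (<⇒≤ k<m)) ⟩
    (m ∸ suc (toℕ k)) + toℕ k                                   ≡⟨ cong pred (trans (sym (+-suc _ (toℕ k))) (m∸n+n≡m k<m)) ⟩
    m ∸ 1                                                       ∎
    where
    open ≡-Reasoning
    k<m : toℕ k ℕ.< m
    k<m = toℕ<n k

  S-size : size S ≡ 2 * (m * m) ∸ m
  S-size = begin
    size S                                                      ≡⟨ size≡∑tally S ⟩
    ∑ (λ a → tally (S a))                                       ≡⟨ ∑-blocks (λ a → tally (S a)) ⟩
    ∑ (λ i → tally (S ⟨ 0F , i ⟩)) + ∑ (λ k → tally (S ⟨ 1F , k ⟩))
      ≡⟨ cong₂ _+_ (sum-cong-≗ S-row-upper) (sum-cong-≗ S-row-lower) ⟩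
    ∑ {m} (λ _ → m) + ∑ {m} (λ _ → m ∸ 1)                       ≡⟨ cong₂ _+_ (∑-const m m) (∑-const m (m ∸ 1)) ⟩
    m * m + m * (m ∸ 1)                                         ≡⟨ cong (m * m +_) (*-distribˡ-∸ m m 1) ⟩
    m * m + (m * m ∸ m * 1)                                     ≡⟨ cong (λ c → m * m + (m * m ∸ c)) (*-identityʳ m) ⟩
    m * m + (m * m ∸ m)                                         ≡⟨ +-∸-assoc (m * m) (m≤m*n m m) ⟨
    (m * m + m * m) ∸ m                                         ≡⟨ cong (λ c → (m * m + c) ∸ m) (+-identityʳ (m * m)) ⟨
    2 * (m * m) ∸ m                                             ∎
    where open ≡-Reasoning

  other : Fin 2 → Fin 2
  other 0F = 1F
  other 1F = 0F

  module Forcing (N : Matrix (2 * m)) (N∈Λ : InΛ (2 * m) m N) (N⊇S : Contains N B S) where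

    Agree : Fin (2 * m) → Fin (2 * m) → Set
    Agree a b = N a b ≡ B a b

    from-S : ∀ s i t j → T (selected s i t j) → Agree ⟨ s , i ⟩ ⟨ t , j ⟩
    from-S s i t j h = N⊇S _ _ (subst T (sym (S-cells s i t j)) h)

    off-block-zeros : ∀ s i → (∀ j → Agree ⟨ s , i ⟩ ⟨ other s , j ⟩) →
      ∀ t j → B ⟨ s , i ⟩ ⟨ t , j ⟩ ≡ false → Agree ⟨ s , i ⟩ ⟨ t , j ⟩
    off-block-zeros 0F i off 0F j B≡false = ⊥-elim (true-and-false (B-cells 0F i 0F j) B≡false)
    off-block-zeros 0F i off 1F j _       = off j
    off-block-zeros 1F i off 0F j _       = off j
    off-block-zeros 1F i off 1F j B≡false = ⊥-elim (true-and-false (B-cells 1F i 1F j) B≡false)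

    on-block-ones : ∀ t j → (∀ i → Agree ⟨ t , i ⟩ ⟨ t , j ⟩) →
      ∀ s i → B ⟨ s , i ⟩ ⟨ t , j ⟩ ≡ true → Agree ⟨ s , i ⟩ ⟨ t , j ⟩
    on-block-ones 0F j on 0F i _      = on i
    on-block-ones 0F j on 1F i B≡true = ⊥-elim (true-and-false B≡true (B-cells 1F i 0F j))
    on-block-ones 1F j on 0F i B≡true = ⊥-elim (true-and-false B≡true (B-cells 0F i 1F j))
    on-block-ones 1F j on 1F i _      = on i

    row-agrees : ∀ s i → (∀ j → Agree ⟨ s , i ⟩ ⟨ other s , j ⟩) → ∀ b → Agree ⟨ s , i ⟩ b
    row-agrees s i off =
      row-forced-by-zeros B-InΛ N∈Λ ⟨ s , i ⟩ (cell-cases _ (off-block-zeros s i off))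

    col-agrees : ∀ t j → (∀ i → Agree ⟨ t , i ⟩ ⟨ t , j ⟩) → ∀ a → Agree a ⟨ t , j ⟩
    col-agrees t j on =
      col-forced-by-ones B-InΛ N∈Λ ⟨ t , j ⟩ (cell-cases _ (on-block-ones t j on))

    record Settled (t : Fin m) : Set where
      field
        upper-row : ∀ b → Agree ⟨ 0F , t ⟩ b
        upper-col : ∀ a → Agree a ⟨ 0F , t ⟩
        lower-row : ∀ b → Agree ⟨ 1F , t ⟩ b
        lower-col : ∀ a → Agree a ⟨ 1F , t ⟩
    open Settled

    around : (P : Fin m → Set) (t : Fin m) →
      (∀ x → t < x → P x) → (∀ x → x < t → P x) → P t → ∀ x → P x
    around P t above below at x with <-cmp t x
    ... | tri< t<x _ _  = above x t<x
    ... | tri≈ _ refl _ = at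
    ... | tri> _ _ x<t  = below x x<t

    -- In each line of offset t, the cells beyond t are in S, those before t are settled
    -- earlier, and the diagonal one was settled by the previous line.
    settle : ∀ t → (∀ {s} → s < t → Settled s) → Settled t
    settle t earlier = record
      { upper-row = rowU ; upper-col = colU ; lower-row = rowD ; lower-col = colD }
      where
      rowU : ∀ b → Agree ⟨ 0F , t ⟩ b
      rowU = row-agrees 0F t (around _ t
        (λ l t<l → from-S 0F t 1F l (≤⇒≤ᵇ (<⇒≤ t<l)))
        (λ l l<t → lower-col (earlier l<t) ⟨ 0F , t ⟩)
        (from-S 0F t 1F t (≤⇒≤ᵇ (≤-refl {toℕ t}))))
      colU : ∀ a → Agree a ⟨ 0F , t ⟩
      colU = col-agrees 0F t (around _ t
        (λ x t<x → from-S 0F x 0F t (<⇒<ᵇ t<x))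
        (λ x x<t → upper-row (earlier x<t) ⟨ 0F , t ⟩)
        (rowU ⟨ 0F , t ⟩))
      rowD : ∀ b → Agree ⟨ 1F , t ⟩ b
      rowD = row-agrees 1F t (around _ t
        (λ j t<j → from-S 1F t 0F j (<⇒<ᵇ t<j))
        (λ j j<t → upper-col (earlier j<t) ⟨ 1F , t ⟩)
        (colU ⟨ 1F , t ⟩))
      colD : ∀ a → Agree a ⟨ 1F , t ⟩
      colD = col-agrees 1F t (around _ t
        (λ k t<k → from-S 1F k 1F t (<⇒<ᵇ t<k))
        (λ k k<t → lower-row (earlier k<t) ⟨ 1F , t ⟩)
        (rowD ⟨ 1F , t ⟩))

    settled : ∀ t → Acc _<_ t → Settled t
    settled t (acc below) = settle t (λ s<t → settled _ (below s<t))

    N≡B : ∀ a b → N a b ≡ B a b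
    N≡B = cell-cases (λ a → ∀ b → N a b ≡ B a b) row
      where
      row : ∀ s i → ∀ b → N ⟨ s , i ⟩ b ≡ B ⟨ s , i ⟩ b
      row 0F i = upper-row (settled i (<-wellFounded i))
      row 1F i = lower-row (settled i (<-wellFounded i))

  S-defining : IsDefiningSet (2 * m) m B S
  S-defining N N∈Λ N⊇S = Forcing.N≡B N N∈Λ N⊇S

  blocks-differ : ∀ {i j} → ⟨ 0F , i ⟩ ≢ ⟨ 1F , j ⟩
  blocks-differ {i} {j} e with combine-injectiveˡ {2} 0F i 1F j e
  ... | ()

  rectangle : (ρ γ : Fin 2 → Fin m) → Interchange B
  rectangle ρ γ = record
    { r₁ = ⟨ 0F , ρ 0F ⟩ ; r₂ = ⟨ 1F , ρ 1F ⟩ ; c₁ = ⟨ 0F , γ 0F ⟩ ; c₂ = ⟨ 1F , γ 1F ⟩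
    ; r₁≢r₂ = blocks-differ ; c₁≢c₂ = blocks-differ
    ; M₁₁ = B-cells 0F (ρ 0F) 0F (γ 0F) ; M₂₂ = B-cells 1F (ρ 1F) 1F (γ 1F)
    ; M₁₂ = B-cells 0F (ρ 0F) 1F (γ 1F) ; M₂₁ = B-cells 1F (ρ 1F) 0F (γ 0F) }

  rectangle-isolates : ∀ ρ γ s₀ t₀ →
    (∀ s t → T (selected s (ρ s) t (γ t)) → s ≡ s₀ × t ≡ t₀) →
    Isolates (rectangle ρ γ) S ⟨ s₀ , ρ s₀ ⟩ ⟨ t₀ , γ t₀ ⟩
  rectangle-isolates ρ γ s₀ t₀ only p q (p-row , q-col) Spq
    with which-of-two (λ s → ⟨ s , ρ s ⟩) p-row | which-of-two (λ t → ⟨ t , γ t ⟩) q-col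
  ... | s , refl | t , refl with only s t (subst T (S-cells s (ρ s) t (γ t)) Spq)
  ... | refl , refl = refl , refl

  pick : Fin m → Fin m → Fin 2 → Fin m
  pick x y 0F = x
  pick x y 1F = y

  -- The isolating rectangle of each selected cell; the other three corners fail their
  -- selection test because it would require a strict inequality between equal offsets or
  -- contradict the inequality selecting the cell.
  isolating-cell : ∀ s i t j → T (selected s i t j) →
    Σ (Interchange B) λ I → Isolates I S ⟨ s , i ⟩ ⟨ t , j ⟩
  isolating-cell 0F i 0F j j<i = rectangle (pick i j) (pick j j) , rectangle-isolates _ _ 0F 0F only
    where
    only : ∀ s t → T (selected s (pick i j s) t (pick j j t)) → s ≡ 0F × t ≡ 0F
    only 0F 0F _   = refl , refl
    only 0F 1F i≤j = ⊥-elim (<ᵇ-not-≥ᵇ (toℕ j) (toℕ i) j<i i≤j)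
    only 1F 0F j<j = ⊥-elim (<ᵇ-irrefl (toℕ j) j<j)
    only 1F 1F j<j = ⊥-elim (<ᵇ-irrefl (toℕ j) j<j)
  isolating-cell 0F i 1F l i≤l = rectangle (pick i l) (pick l l) , rectangle-isolates _ _ 0F 1F only
    where
    only : ∀ s t → T (selected s (pick i l s) t (pick l l t)) → s ≡ 0F × t ≡ 1F
    only 0F 0F l<i = ⊥-elim (<ᵇ-not-≥ᵇ (toℕ l) (toℕ i) l<i i≤l)
    only 0F 1F _   = refl , refl
    only 1F 0F l<l = ⊥-elim (<ᵇ-irrefl (toℕ l) l<l)
    only 1F 1F l<l = ⊥-elim (<ᵇ-irrefl (toℕ l) l<l)
  isolating-cell 1F k 0F j k<j = rectangle (pick j k) (pick j k) , rectangle-isolates _ _ 1F 0F only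
    where
    only : ∀ s t → T (selected s (pick j k s) t (pick j k t)) → s ≡ 1F × t ≡ 0F
    only 0F 0F j<j = ⊥-elim (<ᵇ-irrefl (toℕ j) j<j)
    only 0F 1F j≤k = ⊥-elim (<ᵇ-not-≥ᵇ (toℕ k) (toℕ j) k<j j≤k)
    only 1F 0F _   = refl , refl
    only 1F 1F k<k = ⊥-elim (<ᵇ-irrefl (toℕ k) k<k)
  isolating-cell 1F k 1F l l<k = rectangle (pick k k) (pick k l) , rectangle-isolates _ _ 1F 1F only
    where
    only : ∀ s t → T (selected s (pick k k s) t (pick k l t)) → s ≡ 1F × t ≡ 1F
    only 0F 0F k<k = ⊥-elim (<ᵇ-irrefl (toℕ k) k<k)
    only 0F 1F k≤l = ⊥-elim (<ᵇ-not-≥ᵇ (toℕ l) (toℕ k) l<k k≤l)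
    only 1F 0F k<k = ⊥-elim (<ᵇ-irrefl (toℕ k) k<k)
    only 1F 1F _   = refl , refl

  S-isolated : ∀ a b → T (S a b) → Σ (Interchange B) λ I → Isolates I S a b
  S-isolated = cell-cases _ λ s i → cell-cases _ λ t j Sab →
    isolating-cell s i t j (subst T (S-cells s i t j) Sab)

  S-critical : IsCriticalSet (2 * m) m B S
  S-critical = S-defining , minimal-if-isolated B-InΛ S-isolated

corollary22 : (m : ℕ) → .{{_ : NonZero m}} →
    Σ (CellSet (2 * m)) λ S →
      IsCriticalSet (2 * m) m (Bmat m) S × size S ≡ 2 * (m * m) ∸ m
corollary22 m = S , S-critical , S-size
  where open Block m
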